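{- Let $p$ be a prime, $n\ge1$, $F=\mathbb{F}_{p^n}$, and let $f,g\colon F\to F$ be EA-equivalent. Then $\mathcal N_f=\mathcal N_g$. In particular, $f$ is a GAPN function if and only if $g$ is a GAPN function.
   Context: A map $F\to F$ is affine if it is of the form $x\mapsto \alpha(x)+c$ with $\alpha$ $\mathbb{F}_p$-linear and $c\in F$. Functions $f,g$ are EA-equivalent if $g=A_1\circ f\circ A_2+A_0$ where $A_1,A_2$ are affine permutations of $F$ and $A_0$ is affine. For $a,x\in F$ put $\tilde{D}_a f(x)=\sum_{j\in\mathbb{F}_p} f(x+ja)$, $\tilde N_f(a,b)=\#\{x\in F:\tilde D_af(x)=b\}$, and $\mathcal N_f=\{\tilde N_f(a,b): a\in F^\times, b\in F\}$. $f$ is GAPN if $\tilde N_f(a,b)\le p$ for all $a\in F^\times$, $b\in F$. -}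

module Defs where

open import Data.Nat using (ℕ; zero; suc; NonZero; _≤_)
open import Data.Nat.DivMod using (_%_; m%n<n)
open import Data.Nat.Primality using (Prime; prime⇒nonZero)
open import Data.Fin using (Fin; toℕ; fromℕ<)
open import Data.Fin.Properties using (_≟_)
open import Data.Vec using (Vec; []; _∷_; zipWith; map; replicate)
open import Data.Vec.Properties using (≡-dec)
open import Data.List using (List; length; filter; allFin; concatMap; foldr) renaming ([] to []ₗ; _∷_ to _∷ₗ_; map to mapₗ)
open import Data.Product using (Σ; ∃; _×_; _,_)
open import Relation.Binary.PropositionalEquality using (_≡_; _≢_)
open import Function.Definitions using (Bijective)
open import Function.Bundles using (_⇔_)

-- The prime field F_p = ℤ/pℤ, represented as Fin p with arithmetic mod p.
-- F = F_{p^n} is represented by its additive F_p-vector-space structure F_p^n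
-- (only this structure enters the statement: affine maps are F_p-affine,
-- and D̃ uses only addition and F_p-scalar multiples).
module GF (p : ℕ) (pr : Prime p) (n : ℕ) where
  instance
    p≢0 : NonZero p
    p≢0 = prime⇒nonZero pr

  Fp : Set
  Fp = Fin p

  _+ₚ_ : Fp → Fp → Fp
  a +ₚ b = fromℕ< (m%n<n (toℕ a Data.Nat.+ toℕ b) p)

  _*ₚ_ : Fp → Fp → Fp
  a *ₚ b = fromℕ< (m%n<n (toℕ a Data.Nat.* toℕ b) p)

  0ₚ : Fp
  0ₚ = fromℕ< (m%n<n 0 p)

  F : Set
  F = Vec Fp n

  _⊕_ : F → F → F
  _⊕_ = zipWith _+ₚ_

  _·_ : Fp → F → F
  c · x = map (c *ₚ_) x

  𝟎 : F
  𝟎 = replicate n 0ₚ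

  allVecs : (m : ℕ) → List (Vec Fp m)
  allVecs zero = [] ∷ₗ []ₗ
  allVecs (suc m) = concatMap (λ i → mapₗ (i ∷_) (allVecs m)) (allFin p)

  allF : List F
  allF = allVecs n

  IsLinear : (F → F) → Set
  IsLinear α = (∀ x y → α (x ⊕ y) ≡ α x ⊕ α y) × (∀ (c : Fp) x → α (c · x) ≡ c · α x)

  IsAffine : (F → F) → Set
  IsAffine A = Σ (F → F) λ α → IsLinear α × Σ F λ c → ∀ x → A x ≡ α x ⊕ c

  IsAffinePerm : (F → F) → Set
  IsAffinePerm A = IsAffine A × Bijective _≡_ _≡_ A

  EAEquivalent : (F → F) → (F → F) → Set
  EAEquivalent f g =
    Σ (F → F) λ A₁ → Σ (F → F) λ A₂ → Σ (F → F) λ A₀ →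
      IsAffinePerm A₁ × IsAffinePerm A₂ × IsAffine A₀ ×
      (∀ x → g x ≡ A₁ (f (A₂ x)) ⊕ A₀ x)

  D̃ : (F → F) → F → F → F
  D̃ f a x = foldr (λ j acc → f (x ⊕ (j · a)) ⊕ acc) 𝟎 (allFin p)

  Ñ : (F → F) → F → F → ℕ
  Ñ f a b = length (filter (λ x → ≡-dec _≟_ (D̃ f a x) b) allF)

  _∈𝒩_ : ℕ → (F → F) → Set
  m ∈𝒩 f = Σ F λ a → Σ F λ b → a ≢ 𝟎 × Ñ f a b ≡ m

  SameN : (F → F) → (F → F) → Set
  SameN f g = ∀ m → (m ∈𝒩 f) ⇔ (m ∈𝒩 g)

  IsGAPN : (F → F) → Set
  IsGAPN f = ∀ a b → a ≢ 𝟎 → Ñ f a b ≤ p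

-- Over the coset {x + j a : j ∈ F_p} the sum D̃ kills constants (p·c = 0), commutes with
-- F_p-linear maps, and is transported by an affine substitution x ↦ α x + c to direction α a.
-- Hence for g = A₁ ∘ f ∘ A₂ + A₀ one gets
--   D̃_a g(x) = α₁(D̃_{α₂ a} f(A₂ x)) + α₀(Σ_j j a),
-- where the last term does not depend on x. As A₂ and y ↦ α₁ y + α₀(Σ_j j a) are bijections,
-- Ñ_g(a, ·) is a reindexing of Ñ_f(α₂ a, ·), and α₂ permutes F^× since it is a bijection
-- fixing 0. So 𝒩_f = 𝒩_g, and being GAPN is a property of 𝒩 alone.
module Submission where

open import Algebra.Bundles using (CommutativeMonoid; Group; AbelianGroup)
open import Algebra.Bundles.Raw using (RawMonoid)
import Algebra.Consequences.Propositional as Consequences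
open import Algebra.Core using (Op₁; Op₂)
import Algebra.Definitions.RawMonoid as RawMonoidDefinitions
import Algebra.Properties.CommutativeSemigroup as CommutativeSemigroupProperties
import Algebra.Properties.Group as GroupProperties
open import Algebra.Structures using (IsCommutativeMonoid; IsGroup; IsAbelianGroup)
open import Data.Fin using (toℕ)
open import Data.Fin.Properties using (_≟_; toℕ-fromℕ<; toℕ-injective; toℕ<n)
open import Data.List as List using (List; []; _∷_; length; filter; foldr; allFin)
open import Data.List.Membership.Propositional using (_∈_)
open import Data.List.Membership.Propositional.Properties using (∈-map⁺; ∈-allFin; ∈-cartesianProductWith⁺)
open import Data.List.Membership.Propositional.Properties.WithK using (unique∧set⇒bag)
open import Data.List.Properties using (length-map; length-tabulate; filter-≐)
open import Data.List.Relation.Binary.BagAndSetEquality using (∼bag⇒↭)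
open import Data.List.Relation.Binary.Permutation.Propositional using (_↭_)
open import Data.List.Relation.Binary.Permutation.Propositional.Properties using (↭-length; filter-↭)
import Data.List.Relation.Unary.All as All
import Data.List.Relation.Unary.AllPairs as AllPairs
open import Data.List.Relation.Unary.Any using (here)
open import Data.List.Relation.Unary.Unique.Propositional using (Unique)
import Data.List.Relation.Unary.Unique.Propositional.Properties as Unique
open import Data.Nat using (ℕ; zero; suc; pred; _+_; _*_; _≤_; NonZero; >-nonZero⁻¹)
open import Data.Nat.DivMod using (_%_; %-distribˡ-+; m%n%n≡m%n; m<n⇒m%n≡m; m*n%n≡0)
open import Data.Nat.Primality using (Prime)
import Data.Nat.Properties as ℕ
open import Data.Product using (_×_; _,_; proj₁; proj₂)
open import Data.Vec using (Vec; []; _∷_; zipWith; map; replicate)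
open import Data.Vec.Properties using (∷-injectiveˡ; ∷-injectiveʳ; ≡-dec)
open import Data.Vec.Relation.Binary.Pointwise.Inductive as Pointwise using (Pointwise-≡⇒≡)
open import Function using (_∘_; id; _⇔_; mk⇔; Equivalence)
open import Function.Consequences.Propositional using (strictlySurjective⇒surjective; surjective⇒strictlySurjective)
open import Function.Definitions using (Injective; Surjective; Bijective; StrictlySurjective)
open import Level using (0ℓ)
open import Relation.Binary.PropositionalEquality
open import Relation.Nullary using (yes; no)
open import Relation.Unary using (Pred; Decidable)

open import Defs

module _ {a b ℓ} {A : Set a} {B : Set b} {P : Pred B ℓ} (P? : Decidable P) where

  map-filter-∘ : ∀ (σ : A → B) xs → List.map σ (filter (P? ∘ σ) xs) ≡ filter P? (List.map σ xs)
  map-filter-∘ σ []       = refl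
  map-filter-∘ σ (x ∷ xs) with P? (σ x)
  ... | yes _ = cong (σ x ∷_) (map-filter-∘ σ xs)
  ... | no _  = map-filter-∘ σ xs

module _ {a ℓ} {A : Set a} {P : Pred A ℓ} (P? : Decidable P) where

  length-filter-∘-bijective : ∀ {xs} → Unique xs → (∀ x → x ∈ xs) →
    ∀ {σ} → Bijective _≡_ _≡_ σ → length (filter (P? ∘ σ) xs) ≡ length (filter P? xs)
  length-filter-∘-bijective {xs} unique complete {σ} (σ-injective , σ-surjective) = begin
    length (filter (P? ∘ σ) xs)               ≡⟨ length-map σ (filter (P? ∘ σ) xs) ⟨
    length (List.map σ (filter (P? ∘ σ) xs))  ≡⟨ cong length (map-filter-∘ P? σ xs) ⟩
    length (filter P? (List.map σ xs))        ≡⟨ ↭-length (filter-↭ P? σxs↭xs) ⟩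
    length (filter P? xs)                     ∎
    where
    open ≡-Reasoning
    σxs↭xs : List.map σ xs ↭ xs
    σxs↭xs = ∼bag⇒↭ (unique∧set⇒bag (Unique.map⁺ σ-injective unique) unique (λ {y} → mk⇔
      (λ _ → complete y)
      (λ _ → subst (_∈ List.map σ xs) (proj₂ (σ-surjective y) refl) (∈-map⁺ σ (complete _)))))

module ListSum {a} {A : Set a} {_∙_ : Op₂ A} {ε : A} (isCM : IsCommutativeMonoid _≡_ _∙_ ε) where

  private
    M : CommutativeMonoid a a
    M = record { isCommutativeMonoid = isCM }
  open CommutativeMonoid M using (identityˡ; rawMonoid)
  open CommutativeSemigroupProperties (CommutativeMonoid.commutativeSemigroup M) using (interchange)
  open RawMonoidDefinitions rawMonoid public using () renaming (_×_ to _×ᴬ_)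

  sumOver : ∀ {x} {X : Set x} → List X → (X → A) → A
  sumOver L u = foldr (λ j acc → u j ∙ acc) ε L

  module _ {x} {X : Set x} where

    sumOver-cong : ∀ (L : List X) {u v : X → A} → (∀ j → u j ≡ v j) → sumOver L u ≡ sumOver L v
    sumOver-cong []      u≗v = refl
    sumOver-cong (j ∷ L) u≗v = cong₂ _∙_ (u≗v j) (sumOver-cong L u≗v)

    sumOver-∙ : ∀ (L : List X) (u v : X → A) → sumOver L (λ j → u j ∙ v j) ≡ sumOver L u ∙ sumOver L v
    sumOver-∙ []      u v = sym (identityˡ ε)
    sumOver-∙ (j ∷ L) u v = trans (cong ((u j ∙ v j) ∙_) (sumOver-∙ L u v)) (interchange _ _ _ _)

    sumOver-const : ∀ (L : List X) c → sumOver L (λ _ → c) ≡ length L ×ᴬ c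
    sumOver-const []      c = refl
    sumOver-const (j ∷ L) c = cong (c ∙_) (sumOver-const L c)

    sumOver-homo : ∀ (L : List X) {h : A → A} → h ε ≡ ε → (∀ x y → h (x ∙ y) ≡ h x ∙ h y) →
                   ∀ u → sumOver L (h ∘ u) ≡ h (sumOver L u)
    sumOver-homo []      ε-homo ∙-homo u = sym ε-homo
    sumOver-homo (j ∷ L) ε-homo ∙-homo u = trans (cong (_ ∙_) (sumOver-homo L ε-homo ∙-homo u)) (sym (∙-homo _ _))

module _ {a} {A : Set a} {_∙_ : Op₂ A} {ε : A} {_⁻¹ : Op₁ A} (isGroup : IsGroup _≡_ _∙_ ε _⁻¹) where

  private
    G : Group a a
    G = record { isGroup = isGroup }
  open Group G using (identityˡ; _//_)
  open GroupProperties G using (∙-cancelʳ; //-rightDividesˡ)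

  ∙-homo⇒ε-homo : ∀ {h : A → A} → (∀ x y → h (x ∙ y) ≡ h x ∙ h y) → h ε ≡ ε
  ∙-homo⇒ε-homo {h} ∙-homo = ∙-cancelʳ (h ε) (h ε) ε (begin
    h ε ∙ h ε    ≡⟨ ∙-homo ε ε ⟨
    h (ε ∙ ε)    ≡⟨ cong h (identityˡ ε) ⟩
    h ε          ≡⟨ identityˡ (h ε) ⟨
    ε ∙ h ε      ∎)
    where open ≡-Reasoning

  translate-bijective⇔bijective : ∀ {k h : A → A} {c} → (∀ x → k x ≡ h x ∙ c) →
                                  Bijective _≡_ _≡_ k ⇔ Bijective _≡_ _≡_ h
  translate-bijective⇔bijective {k} {h} {c} k≗h∙c = mk⇔ to from
    where
    cancel : ∀ {x y} → k x ≡ k y → h x ≡ h y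
    cancel {x} {y} kx≡ky = ∙-cancelʳ c _ _ (trans (sym (k≗h∙c x)) (trans kx≡ky (k≗h∙c y)))

    to : Bijective _≡_ _≡_ k → Bijective _≡_ _≡_ h
    to (k-injective , k-surjective) = h-injective , strictlySurjective⇒surjective h-surjective
      where
      h-injective : Injective _≡_ _≡_ h
      h-injective {x} {y} hx≡hy = k-injective (trans (k≗h∙c x) (trans (cong (_∙ c) hx≡hy) (sym (k≗h∙c y))))
      h-surjective : StrictlySurjective _≡_ h
      h-surjective t with x , kx≡t∙c ← surjective⇒strictlySurjective k-surjective (t ∙ c) =
        x , ∙-cancelʳ c _ _ (trans (sym (k≗h∙c x)) kx≡t∙c)

    from : Bijective _≡_ _≡_ h → Bijective _≡_ _≡_ k
    from (h-injective , h-surjective) = h-injective ∘ cancel , strictlySurjective⇒surjective k-surjective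
      where
      k-surjective : StrictlySurjective _≡_ k
      k-surjective t with x , hx≡t//c ← surjective⇒strictlySurjective h-surjective (t // c) =
        x , trans (k≗h∙c x) (trans (cong (_∙ c) hx≡t//c) (//-rightDividesˡ c t))

module _ {a} {A : Set a} {_∙_ : Op₂ A} {ε : A} {_⁻¹ : Op₁ A} (isAbelianGroup : IsAbelianGroup _≡_ _∙_ ε _⁻¹) where

  open IsAbelianGroup isAbelianGroup using (assoc; comm; identity; inverseʳ)

  zipWith-inverseʳ : ∀ {m} (xs : Vec A m) → zipWith _∙_ xs (map _⁻¹ xs) ≡ replicate m ε
  zipWith-inverseʳ []       = refl
  zipWith-inverseʳ (x ∷ xs) = cong₂ _∷_ (inverseʳ x) (zipWith-inverseʳ xs)

  zipWith-isAbelianGroup : ∀ m → IsAbelianGroup _≡_ (zipWith {n = m} _∙_) (replicate m ε) (map _⁻¹)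
  zipWith-isAbelianGroup m = record
    { isGroup = record
      { isMonoid = record
        { isSemigroup = record
          { isMagma = record { isEquivalence = isEquivalence ; ∙-cong = cong₂ _ }
          ; assoc   = λ xs ys zs → Pointwise-≡⇒≡ (Pointwise.zipWith-assoc assoc xs ys zs)
          }
        ; identity = (λ xs → Pointwise-≡⇒≡ (Pointwise.zipWith-identityˡ (proj₁ identity) xs))
                   , (λ xs → Pointwise-≡⇒≡ (Pointwise.zipWith-identityʳ (proj₂ identity) xs))
        }
      ; inverse = Consequences.comm∧invʳ⇒invˡ zipWith-comm zipWith-inverseʳ , zipWith-inverseʳ
      ; ⁻¹-cong = cong _
      }
    ; comm = zipWith-comm
    }
    where
    zipWith-comm : ∀ (xs ys : Vec A m) → zipWith _∙_ xs ys ≡ zipWith _∙_ ys xs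
    zipWith-comm xs ys = Pointwise-≡⇒≡ (Pointwise.zipWith-comm comm xs ys)

  zipWith-abelianGroup : ℕ → AbelianGroup a a
  zipWith-abelianGroup m = record { isAbelianGroup = zipWith-isAbelianGroup m }

  private
    𝔸 : AbelianGroup a a
    𝔸 = record { isAbelianGroup = isAbelianGroup }
  open RawMonoidDefinitions (AbelianGroup.rawMonoid 𝔸) using () renaming (_×_ to _×ᴬ_)

  _×ᵥ_ : ∀ {m} → ℕ → Vec A m → Vec A m
  _×ᵥ_ {m} = RawMonoidDefinitions._×_ (AbelianGroup.rawMonoid (zipWith-abelianGroup m))

  ×-annihilates⇒×ᵥ-annihilates : ∀ k → (∀ x → k ×ᴬ x ≡ ε) → ∀ {m} (xs : Vec A m) → k ×ᵥ xs ≡ replicate m ε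
  ×-annihilates⇒×ᵥ-annihilates k k×≡ε []       = ×ᵥ-[] k
    where
    ×ᵥ-[] : ∀ j → j ×ᵥ [] ≡ []
    ×ᵥ-[] zero    = refl
    ×ᵥ-[] (suc j) = cong (zipWith _∙_ []) (×ᵥ-[] j)
  ×-annihilates⇒×ᵥ-annihilates k k×≡ε (x ∷ xs) =
    trans (×ᵥ-∷ k) (cong₂ _∷_ (k×≡ε x) (×-annihilates⇒×ᵥ-annihilates k k×≡ε xs))
    where
    ×ᵥ-∷ : ∀ j → j ×ᵥ (x ∷ xs) ≡ j ×ᴬ x ∷ j ×ᵥ xs
    ×ᵥ-∷ zero    = refl
    ×ᵥ-∷ (suc j) = cong (zipWith _∙_ (x ∷ xs)) (×ᵥ-∷ j)

[m%d+n]%d≡[m+n]%d : ∀ m n d .{{_ : NonZero d}} → (m % d + n) % d ≡ (m + n) % d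
[m%d+n]%d≡[m+n]%d m n d = begin
  (m % d + n) % d          ≡⟨ %-distribˡ-+ (m % d) n d ⟩
  (m % d % d + n % d) % d  ≡⟨ cong (λ r → (r + n % d) % d) (m%n%n≡m%n m d) ⟩
  (m % d + n % d) % d      ≡⟨ %-distribˡ-+ m n d ⟨
  (m + n) % d              ∎
  where open ≡-Reasoning

[m+n%d]%d≡[m+n]%d : ∀ m n d .{{_ : NonZero d}} → (m + n % d) % d ≡ (m + n) % d
[m+n%d]%d≡[m+n]%d m n d = begin
  (m + n % d) % d  ≡⟨ cong (_% d) (ℕ.+-comm m (n % d)) ⟩
  (n % d + m) % d  ≡⟨ [m%d+n]%d≡[m+n]%d n m d ⟩
  (n + m) % d      ≡⟨ cong (_% d) (ℕ.+-comm n m) ⟩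
  (m + n) % d      ∎
  where open ≡-Reasoning

module _ (p : ℕ) (pr : Prime p) (n : ℕ) where

  open GF p pr n

  toℕ-+ₚ : ∀ a b → toℕ (a +ₚ b) ≡ (toℕ a + toℕ b) % p
  toℕ-+ₚ a b = toℕ-fromℕ< _

  toℕ-0ₚ : toℕ 0ₚ ≡ 0
  toℕ-0ₚ = trans (toℕ-fromℕ< _) (m<n⇒m%n≡m (>-nonZero⁻¹ p))

  +ₚ-comm : ∀ a b → a +ₚ b ≡ b +ₚ a
  +ₚ-comm a b = toℕ-injective (begin
    toℕ (a +ₚ b)           ≡⟨ toℕ-+ₚ a b ⟩
    (toℕ a + toℕ b) % p    ≡⟨ cong (_% p) (ℕ.+-comm (toℕ a) (toℕ b)) ⟩
    (toℕ b + toℕ a) % p    ≡⟨ toℕ-+ₚ b a ⟨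
    toℕ (b +ₚ a)           ∎)
    where open ≡-Reasoning

  +ₚ-assoc : ∀ a b c → (a +ₚ b) +ₚ c ≡ a +ₚ (b +ₚ c)
  +ₚ-assoc a b c = toℕ-injective (begin
    toℕ ((a +ₚ b) +ₚ c)                  ≡⟨ toℕ-+ₚ (a +ₚ b) c ⟩
    (toℕ (a +ₚ b) + toℕ c) % p           ≡⟨ cong (λ r → (r + toℕ c) % p) (toℕ-+ₚ a b) ⟩
    ((toℕ a + toℕ b) % p + toℕ c) % p    ≡⟨ [m%d+n]%d≡[m+n]%d (toℕ a + toℕ b) (toℕ c) p ⟩
    (toℕ a + toℕ b + toℕ c) % p          ≡⟨ cong (_% p) (ℕ.+-assoc (toℕ a) (toℕ b) (toℕ c)) ⟩
    (toℕ a + (toℕ b + toℕ c)) % p        ≡⟨ [m+n%d]%d≡[m+n]%d (toℕ a) (toℕ b + toℕ c) p ⟨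
    (toℕ a + (toℕ b + toℕ c) % p) % p    ≡⟨ cong (λ r → (toℕ a + r) % p) (toℕ-+ₚ b c) ⟨
    (toℕ a + toℕ (b +ₚ c)) % p           ≡⟨ toℕ-+ₚ a (b +ₚ c) ⟨
    toℕ (a +ₚ (b +ₚ c))                  ∎)
    where open ≡-Reasoning

  +ₚ-identityˡ : ∀ a → 0ₚ +ₚ a ≡ a
  +ₚ-identityˡ a = toℕ-injective (begin
    toℕ (0ₚ +ₚ a)            ≡⟨ toℕ-+ₚ 0ₚ a ⟩
    (toℕ 0ₚ + toℕ a) % p     ≡⟨ cong (λ r → (r + toℕ a) % p) toℕ-0ₚ ⟩
    toℕ a % p                ≡⟨ m<n⇒m%n≡m (toℕ<n a) ⟩
    toℕ a                    ∎)
    where open ≡-Reasoning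

  +ₚ-rawMonoid : RawMonoid 0ℓ 0ℓ
  +ₚ-rawMonoid = record { Carrier = Fp ; _≈_ = _≡_ ; _∙_ = _+ₚ_ ; ε = 0ₚ }

  open RawMonoidDefinitions +ₚ-rawMonoid using () renaming (_×_ to _×ₚ_)

  toℕ-×ₚ : ∀ k a → toℕ (k ×ₚ a) ≡ (k * toℕ a) % p
  toℕ-×ₚ zero    a = toℕ-fromℕ< _
  toℕ-×ₚ (suc k) a = begin
    toℕ (a +ₚ (k ×ₚ a))               ≡⟨ toℕ-+ₚ a (k ×ₚ a) ⟩
    (toℕ a + toℕ (k ×ₚ a)) % p        ≡⟨ cong (λ r → (toℕ a + r) % p) (toℕ-×ₚ k a) ⟩
    (toℕ a + (k * toℕ a) % p) % p     ≡⟨ [m+n%d]%d≡[m+n]%d (toℕ a) (k * toℕ a) p ⟩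
    (toℕ a + k * toℕ a) % p           ∎
    where open ≡-Reasoning

  p×ₚ≡0ₚ : ∀ a → p ×ₚ a ≡ 0ₚ
  p×ₚ≡0ₚ a = toℕ-injective (begin
    toℕ (p ×ₚ a)       ≡⟨ toℕ-×ₚ p a ⟩
    (p * toℕ a) % p    ≡⟨ cong (_% p) (ℕ.*-comm p (toℕ a)) ⟩
    (toℕ a * p) % p    ≡⟨ m*n%n≡0 (toℕ a) p ⟩
    0                  ≡⟨ toℕ-0ₚ ⟨
    toℕ 0ₚ             ∎)
    where open ≡-Reasoning

  -ₚ_ : Fp → Fp
  -ₚ a = pred p ×ₚ a

  +ₚ-inverseʳ : ∀ a → a +ₚ (-ₚ a) ≡ 0ₚ
  +ₚ-inverseʳ a = trans (cong (_×ₚ a) (ℕ.suc-pred p)) (p×ₚ≡0ₚ a)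

  +ₚ-isAbelianGroup : IsAbelianGroup _≡_ _+ₚ_ 0ₚ -ₚ_
  +ₚ-isAbelianGroup = record
    { isGroup = record
      { isMonoid = record
        { isSemigroup = record
          { isMagma = record { isEquivalence = isEquivalence ; ∙-cong = cong₂ _+ₚ_ }
          ; assoc   = +ₚ-assoc
          }
        ; identity = Consequences.comm∧idˡ⇒id +ₚ-comm +ₚ-identityˡ
        }
      ; inverse = Consequences.comm∧invʳ⇒inv +ₚ-comm +ₚ-inverseʳ
      ; ⁻¹-cong = cong -ₚ_
      }
    ; comm = +ₚ-comm
    }

  ⊕-abelianGroup : AbelianGroup 0ℓ 0ℓ
  ⊕-abelianGroup = zipWith-abelianGroup +ₚ-isAbelianGroup n

  open AbelianGroup ⊕-abelianGroup using (identityˡ; identityʳ; isGroup; isCommutativeMonoid; commutativeSemigroup)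
  open CommutativeSemigroupProperties commutativeSemigroup using (xy∙z≈xz∙y)
  open ListSum isCommutativeMonoid using (_×ᴬ_; sumOver; sumOver-cong; sumOver-∙; sumOver-const; sumOver-homo)

  sumₚ : (Fp → F) → F
  sumₚ = sumOver (allFin p)

  sumₚ-const : ∀ c → sumₚ (λ _ → c) ≡ 𝟎
  sumₚ-const c = begin
    sumₚ (λ _ → c)            ≡⟨ sumOver-const (allFin p) c ⟩
    length (allFin p) ×ᴬ c    ≡⟨ cong (_×ᴬ c) (length-tabulate {n = p} id) ⟩
    p ×ᴬ c                    ≡⟨ ×-annihilates⇒×ᵥ-annihilates +ₚ-isAbelianGroup p p×ₚ≡0ₚ c ⟩
    𝟎                         ∎
    where open ≡-Reasoning

  additive⇒𝟎-preserving : ∀ {α} → IsLinear α → α 𝟎 ≡ 𝟎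
  additive⇒𝟎-preserving (α-additive , _) = ∙-homo⇒ε-homo isGroup α-additive

  D̃-cong : ∀ {f h : F → F} → (∀ y → f y ≡ h y) → ∀ a x → D̃ f a x ≡ D̃ h a x
  D̃-cong f≗h a x = sumOver-cong (allFin p) (λ j → f≗h (x ⊕ (j · a)))

  D̃-⊕ : ∀ (f h : F → F) a x → D̃ (λ y → f y ⊕ h y) a x ≡ D̃ f a x ⊕ D̃ h a x
  D̃-⊕ f h a x = sumOver-∙ (allFin p) _ _

  D̃-id : ∀ a x → D̃ id a x ≡ sumₚ (λ j → j · a)
  D̃-id a x = begin
    sumₚ (λ j → x ⊕ (j · a))             ≡⟨ sumOver-∙ (allFin p) _ _ ⟩
    sumₚ (λ _ → x) ⊕ sumₚ (λ j → j · a)  ≡⟨ cong (_⊕ _) (sumₚ-const x) ⟩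
    𝟎 ⊕ sumₚ (λ j → j · a)               ≡⟨ identityˡ _ ⟩
    sumₚ (λ j → j · a)                   ∎
    where open ≡-Reasoning

  D̃-linear∘ : ∀ {α} → IsLinear α → ∀ (h : F → F) a x → D̃ (α ∘ h) a x ≡ α (D̃ h a x)
  D̃-linear∘ α-linear h a x = sumOver-homo (allFin p) (additive⇒𝟎-preserving α-linear) (proj₁ α-linear) _

  module _ {A α : F → F} {c : F} (α-linear : IsLinear α) (A≗α⊕c : ∀ y → A y ≡ α y ⊕ c) where

    D̃-affine∘ : ∀ (h : F → F) a x → D̃ (A ∘ h) a x ≡ α (D̃ h a x)
    D̃-affine∘ h a x = begin
      D̃ (A ∘ h) a x                    ≡⟨ D̃-cong (A≗α⊕c ∘ h) a x ⟩
      D̃ (λ y → α (h y) ⊕ c) a x        ≡⟨ D̃-⊕ (α ∘ h) (λ _ → c) a x ⟩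
      D̃ (α ∘ h) a x ⊕ D̃ (λ _ → c) a x  ≡⟨ cong₂ _⊕_ (D̃-linear∘ α-linear h a x) (sumₚ-const c) ⟩
      α (D̃ h a x) ⊕ 𝟎                  ≡⟨ identityʳ _ ⟩
      α (D̃ h a x)                      ∎
      where open ≡-Reasoning

    affine-⊕ : ∀ x y → A (x ⊕ y) ≡ A x ⊕ α y
    affine-⊕ x y = begin
      A (x ⊕ y)          ≡⟨ A≗α⊕c (x ⊕ y) ⟩
      α (x ⊕ y) ⊕ c      ≡⟨ cong (_⊕ c) (proj₁ α-linear x y) ⟩
      (α x ⊕ α y) ⊕ c    ≡⟨ xy∙z≈xz∙y (α x) (α y) c ⟩
      (α x ⊕ c) ⊕ α y    ≡⟨ cong (_⊕ α y) (A≗α⊕c x) ⟨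
      A x ⊕ α y          ∎
      where open ≡-Reasoning

    D̃-∘affine : ∀ (h : F → F) a x → D̃ (h ∘ A) a x ≡ D̃ h (α a) (A x)
    D̃-∘affine h a x = sumOver-cong (allFin p) λ j →
      cong h (trans (affine-⊕ x (j · a)) (cong (A x ⊕_) (proj₂ α-linear j a)))

  D̃-EA : ∀ (f g : F → F) {A₁ A₂ A₀ α₁ α₂ α₀ : F → F} {c₁ c₂ c₀ : F} →
         IsLinear α₁ → (∀ y → A₁ y ≡ α₁ y ⊕ c₁) →
         IsLinear α₂ → (∀ y → A₂ y ≡ α₂ y ⊕ c₂) →
         IsLinear α₀ → (∀ y → A₀ y ≡ α₀ y ⊕ c₀) →
         (∀ x → g x ≡ A₁ (f (A₂ x)) ⊕ A₀ x) →
         ∀ a x → D̃ g a x ≡ α₁ (D̃ f (α₂ a) (A₂ x)) ⊕ α₀ (sumₚ (λ j → j · a))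
  D̃-EA f g {A₁} {A₂} {A₀} {α₁} {α₂} {α₀} α₁-linear A₁-affine α₂-linear A₂-affine α₀-linear A₀-affine g≗ a x =
    begin
    D̃ g a x                                          ≡⟨ D̃-cong g≗ a x ⟩
    D̃ (λ y → A₁ (f (A₂ y)) ⊕ A₀ y) a x               ≡⟨ D̃-⊕ (A₁ ∘ f ∘ A₂) A₀ a x ⟩
    D̃ (A₁ ∘ f ∘ A₂) a x ⊕ D̃ (A₀ ∘ id) a x            ≡⟨ cong₂ _⊕_ (D̃-affine∘ α₁-linear A₁-affine (f ∘ A₂) a x)
                                                                   (D̃-affine∘ α₀-linear A₀-affine id a x) ⟩
    α₁ (D̃ (f ∘ A₂) a x) ⊕ α₀ (D̃ id a x)              ≡⟨ cong₂ (λ u v → α₁ u ⊕ α₀ v)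
                                                                   (D̃-∘affine α₂-linear A₂-affine f a x) (D̃-id a x) ⟩
    α₁ (D̃ f (α₂ a) (A₂ x)) ⊕ α₀ (sumₚ (λ j → j · a))  ∎
    where open ≡-Reasoning
  concatMap-∷≡cartesianProduct : ∀ {m} (as : List Fp) (vs : List (Vec Fp m)) →
    List.concatMap (λ i → List.map (i ∷_) vs) as ≡ List.cartesianProductWith _∷_ as vs
  concatMap-∷≡cartesianProduct []       vs = refl
  concatMap-∷≡cartesianProduct (a ∷ as) vs = cong (List.map (a ∷_) vs List.++_) (concatMap-∷≡cartesianProduct as vs)

  allVecs-unique : ∀ m → Unique (allVecs m)
  allVecs-unique zero    = All.[] AllPairs.∷ AllPairs.[]
  allVecs-unique (suc m) rewrite concatMap-∷≡cartesianProduct (allFin p) (allVecs m) =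
    Unique.cartesianProductWith⁺ _∷_ (λ eq → ∷-injectiveˡ eq , ∷-injectiveʳ eq) (Unique.allFin⁺ p) (allVecs-unique m)

  ∈-allVecs : ∀ {m} (v : Vec Fp m) → v ∈ allVecs m
  ∈-allVecs []      = here refl
  ∈-allVecs {suc m} (a ∷ v) rewrite concatMap-∷≡cartesianProduct (allFin p) (allVecs m) =
    ∈-cartesianProductWith⁺ _∷_ (∈-allFin a) (∈-allVecs v)

  Ñ-transport : ∀ (f g : F → F) {a a′ : F} {σ τ : F → F} → Bijective _≡_ _≡_ σ → Injective _≡_ _≡_ τ →
                (∀ x → D̃ g a x ≡ τ (D̃ f a′ (σ x))) → ∀ b → Ñ g a (τ b) ≡ Ñ f a′ b
  Ñ-transport f g {a} {a′} {σ} {τ} σ-bijective τ-injective D̃g≗τ∘D̃f∘σ b = begin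
    length (filter (λ x → ≡-dec _≟_ (D̃ g a x) (τ b)) allF)      ≡⟨ cong length (filter-≐ _ _ (⇒ , ⇐) allF) ⟩
    length (filter (D̃f≟b ∘ σ) allF)                            ≡⟨ length-filter-∘-bijective D̃f≟b
                                                                    (allVecs-unique n) ∈-allVecs σ-bijective ⟩
    Ñ f a′ b                                                    ∎
    where
    open ≡-Reasoning
    D̃f≟b : Decidable (λ y → D̃ f a′ y ≡ b)
    D̃f≟b y = ≡-dec _≟_ (D̃ f a′ y) b
    ⇒ : ∀ {x} → D̃ g a x ≡ τ b → D̃ f a′ (σ x) ≡ b
    ⇒ {x} eq = τ-injective (trans (sym (D̃g≗τ∘D̃f∘σ x)) eq)
    ⇐ : ∀ {x} → D̃ f a′ (σ x) ≡ b → D̃ g a x ≡ τ b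
    ⇐ {x} eq = trans (D̃g≗τ∘D̃f∘σ x) (cong τ eq)

  SameN-reindex : ∀ (f g : F → F) {α : F → F} {τ : F → F → F} →
    Bijective _≡_ _≡_ α → α 𝟎 ≡ 𝟎 → (∀ a → Surjective _≡_ _≡_ (τ a)) →
    (∀ a b → Ñ g a (τ a b) ≡ Ñ f (α a) b) → SameN f g
  SameN-reindex f g {α} {τ} (α-injective , α-surjective) α𝟎≡𝟎 τ-surjective Ñg≡Ñf m = mk⇔ to from
    where
    to : m ∈𝒩 f → m ∈𝒩 g
    to (a′ , b , a′≢𝟎 , Ñ≡m) with a , refl ← surjective⇒strictlySurjective α-surjective a′ =
      a , τ a b , (λ a≡𝟎 → a′≢𝟎 (trans (cong α a≡𝟎) α𝟎≡𝟎)) , trans (Ñg≡Ñf a b) Ñ≡m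
    from : m ∈𝒩 g → m ∈𝒩 f
    from (a , b , a≢𝟎 , Ñ≡m) with b′ , refl ← surjective⇒strictlySurjective (τ-surjective a) b =
      α a , b′ , (λ αa≡𝟎 → a≢𝟎 (α-injective (trans αa≡𝟎 (sym α𝟎≡𝟎)))) , trans (sym (Ñg≡Ñf a b′)) Ñ≡m

  EA⇒SameN : ∀ (f g : F → F) → EAEquivalent f g → SameN f g
  EA⇒SameN f g (A₁ , A₂ , A₀ , ((α₁ , α₁-linear , c₁ , A₁-affine) , A₁-bijective) ,
                ((α₂ , α₂-linear , c₂ , A₂-affine) , A₂-bijective) , (α₀ , α₀-linear , c₀ , A₀-affine) , g≗) =
    SameN-reindex f g {α₂} {τ} α₂-bijective (additive⇒𝟎-preserving α₂-linear) (proj₂ ∘ τ-bijective) λ a →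
      Ñ-transport f g A₂-bijective (proj₁ (τ-bijective a))
        (D̃-EA f g α₁-linear A₁-affine α₂-linear A₂-affine α₀-linear A₀-affine g≗ a)
    where
    τ : F → F → F
    τ a y = α₁ y ⊕ α₀ (sumₚ (λ j → j · a))
    α₁-bijective : Bijective _≡_ _≡_ α₁
    α₁-bijective = Equivalence.to (translate-bijective⇔bijective isGroup A₁-affine) A₁-bijective
    α₂-bijective : Bijective _≡_ _≡_ α₂
    α₂-bijective = Equivalence.to (translate-bijective⇔bijective isGroup A₂-affine) A₂-bijective
    τ-bijective : ∀ a → Bijective _≡_ _≡_ (τ a)
    τ-bijective a = Equivalence.from (translate-bijective⇔bijective isGroup (λ _ → refl)) α₁-bijective

  𝒩-⊆⇒IsGAPN : ∀ {f g : F → F} → (∀ m → m ∈𝒩 g → m ∈𝒩 f) → IsGAPN f → IsGAPN g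
  𝒩-⊆⇒IsGAPN {f} {g} 𝒩g⊆𝒩f f-GAPN a b a≢𝟎
    with a′ , b′ , a′≢𝟎 , Ñ≡ ← 𝒩g⊆𝒩f (Ñ g a b) (a , b , a≢𝟎 , refl) =
    subst (_≤ p) Ñ≡ (f-GAPN a′ b′ a′≢𝟎)

proposition2p1 : (p : ℕ) (pr : Prime p) (n : ℕ) → 1 ≤ n →
    (f g : GF.F p pr n → GF.F p pr n) → GF.EAEquivalent p pr n f g →
    GF.SameN p pr n f g × (GF.IsGAPN p pr n f ⇔ GF.IsGAPN p pr n g)
proposition2p1 p pr n _ f g f∼g =
  sameN , mk⇔ (𝒩-⊆⇒IsGAPN p pr n {f} {g} (λ m → Equivalence.from (sameN m)))
              (𝒩-⊆⇒IsGAPN p pr n {g} {f} (λ m → Equivalence.to (sameN m)))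
  where
  sameN : GF.SameN p pr n f g
  sameN = EA⇒SameN p pr n f g f∼g
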